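{- Let $\pi,\pi'$ be meLL proof nets with conclusions $\Gamma,A$ and $\Delta,A^\perp$ respectively, and let $\pi''$ be the proof net obtained by adding a cut link whose premises are the conclusion $A$ of $\pi$ and the conclusion $A^\perp$ of $\pi'$. If $\pi$ and $\pi'$ both admit an indexing, then so does $\pi''$.
   Context: meLL proof nets are the usual (sequentializable) proof nets of second-order multiplicative exponential linear logic with paragraph modality: graphs of axiom, cut, tensor, par, for all, exists, paragraph, of course, flat, pax and why not links with exponential boxes. An indexing of a net is a map $I$ from edges to $\mathbb Z$ such that: the two conclusions of an axiom have equal index; the two premises of a cut have equal index; for tensor, par, for all, exists, pax and why not links all premises and the conclusion have equal index; for of course, paragraph and flat links the premise has index one more than the conclusion; and all conclusions of the net have the same index. -}

module Defs where

open import Data.Nat using (ℕ; zero; suc; _≡ᵇ_; _<ᵇ_) renaming (_+_ to _+ℕ_)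
open import Data.Bool using (Bool; true; false; _∨_; _∧_; if_then_else_)
open import Data.Fin using (Fin; _↑ˡ_; _↑ʳ_; splitAt; zero; suc)
open import Data.Sum using ([_,_]′)
open import Data.List using (List; []; _∷_; _++_; map; length; lookup; allFin)
open import Data.List.Relation.Unary.All using (All)
open import Data.List.Relation.Binary.Permutation.Propositional using (_↭_)
open import Data.Integer using (ℤ; _+_; 1ℤ)
open import Data.Product using (Σ; ∃; _×_; _,_)
open import Relation.Binary.PropositionalEquality using (_≡_)

-- Second-order meLL formulas with paragraph (locally nameless syntax):
-- free propositional variables X / X⊥ are named by ℕ (atom / natom),
-- bound variables are de Bruijn indices (bvar / nbvar).

data Fm : Set where
  atom natom : ℕ → Fm
  bvar nbvar : ℕ → Fm
  _⊗_ _⅋_   : Fm → Fm → Fm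
  ∀F ∃F     : Fm → Fm
  !F ?F §F  : Fm → Fm

_⊥ : Fm → Fm
atom X ⊥ = natom X
natom X ⊥ = atom X
bvar n ⊥ = nbvar n
nbvar n ⊥ = bvar n
(A ⊗ B) ⊥ = (A ⊥) ⅋ (B ⊥)
(A ⅋ B) ⊥ = (A ⊥) ⊗ (B ⊥)
∀F A ⊥ = ∃F (A ⊥)
∃F A ⊥ = ∀F (A ⊥)
!F A ⊥ = ?F (A ⊥)
?F A ⊥ = !F (A ⊥)
§F A ⊥ = §F (A ⊥)

inst : ℕ → Fm → Fm → Fm
inst k B (atom X) = atom X
inst k B (natom X) = natom X
inst k B (bvar n) = if n ≡ᵇ k then B else bvar n
inst k B (nbvar n) = if n ≡ᵇ k then B ⊥ else nbvar n
inst k B (A ⊗ C) = inst k B A ⊗ inst k B C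
inst k B (A ⅋ C) = inst k B A ⅋ inst k B C
inst k B (∀F A) = ∀F (inst (suc k) B A)
inst k B (∃F A) = ∃F (inst (suc k) B A)
inst k B (!F A) = !F (inst k B A)
inst k B (?F A) = ?F (inst k B A)
inst k B (§F A) = §F (inst k B A)

lcAt : ℕ → Fm → Bool
lcAt k (atom X) = true
lcAt k (natom X) = true
lcAt k (bvar n) = n <ᵇ k
lcAt k (nbvar n) = n <ᵇ k
lcAt k (A ⊗ C) = lcAt k A ∧ lcAt k C
lcAt k (A ⅋ C) = lcAt k A ∧ lcAt k C
lcAt k (∀F A) = lcAt (suc k) A
lcAt k (∃F A) = lcAt (suc k) A
lcAt k (!F A) = lcAt k A
lcAt k (?F A) = lcAt k A
lcAt k (§F A) = lcAt k A

Closed : Fm → Set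
Closed A = lcAt 0 A ≡ true

occurs : ℕ → Fm → Bool
occurs X (atom Y) = X ≡ᵇ Y
occurs X (natom Y) = X ≡ᵇ Y
occurs X (bvar n) = false
occurs X (nbvar n) = false
occurs X (A ⊗ C) = occurs X A ∨ occurs X C
occurs X (A ⅋ C) = occurs X A ∨ occurs X C
occurs X (∀F A) = occurs X A
occurs X (∃F A) = occurs X A
occurs X (!F A) = occurs X A
occurs X (?F A) = occurs X A
occurs X (§F A) = occurs X A

data Kind : Set where
  axL cutL tensL parL allL exL paraL ofcL flatL paxL whyL : Kind

record Link (n : ℕ) : Set where
  constructor link
  field
    kind : Kind
    prem : List (Fin n)
    conc : List (Fin n)

record Box (n : ℕ) : Set where
  constructor box
  field
    doors    : List (Fin n)
    contents : List (Fin n)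

mapLink : ∀ {m n} → (Fin m → Fin n) → Link m → Link n
mapLink f (link k ps cs) = link k (map f ps) (map f cs)

mapBox : ∀ {m n} → (Fin m → Fin n) → Box m → Box n
mapBox f (box ds cs) = box (map f ds) (map f cs)

record PS : Set where
  constructor ps
  field
    nE    : ℕ
    lab   : Fin nE → Fm
    links : List (Link nE)
    boxes : List (Box nE)
    concl : List (Fin nE)
open PS public

cutNet : (π π' : PS) → List (Fin (nE π)) → Fin (nE π) →
         List (Fin (nE π')) → Fin (nE π') → PS
cutNet π π' Γ a Δ a' = ps (n +ℕ n')
  (λ e → [ lab π , lab π' ]′ (splitAt n e))
  (map (mapLink l) (links π) ++ map (mapLink r) (links π')
     ++ (link cutL (l a ∷ r a' ∷ []) [] ∷ []))
  (map (mapBox l) (boxes π) ++ map (mapBox r) (boxes π'))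
  (map l Γ ++ map r Δ)
  where
    n = nE π
    n' = nE π'
    l : Fin n → Fin (n +ℕ n')
    l e = e ↑ˡ n'
    r : Fin n' → Fin (n +ℕ n')
    r e = n ↑ʳ e

union : PS → PS → PS
union π π' = ps (n +ℕ n')
  (λ e → [ lab π , lab π' ]′ (splitAt n e))
  (map (mapLink l) (links π) ++ map (mapLink r) (links π'))
  (map (mapBox l) (boxes π) ++ map (mapBox r) (boxes π'))
  (map l (concl π) ++ map r (concl π'))
  where
    n = nE π
    n' = nE π'
    l : Fin n → Fin (n +ℕ n')
    l e = e ↑ˡ n'
    r : Fin n' → Fin (n +ℕ n')
    r e = n ↑ʳ e

old1 : ∀ {n} → Fin n → Fin (n +ℕ 1)
old1 e = e ↑ˡ 1

new1 : ∀ n → Fin (n +ℕ 1)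
new1 n = n ↑ʳ zero

linkNet : (π : PS) → Kind → List (Fin (nE π)) → List (Fin (nE π)) → Fm → PS
linkNet π k Γ qs L = ps (nE π +ℕ 1)
  (λ e → [ lab π , (λ _ → L) ]′ (splitAt (nE π) e))
  (map (mapLink old1) (links π) ++ (link k (map old1 qs) (new1 (nE π) ∷ []) ∷ []))
  (map (mapBox old1) (boxes π))
  (map old1 Γ ++ (new1 (nE π) ∷ []))

-- a door specification: premise edge, kind of door link, label of new edge
Door : ℕ → Set
Door n = Fin n × Kind × Fm

doorLink : ∀ {n} (ds : List (Door n)) → Fin (length ds) → Link (n +ℕ length ds)
doorLink {n} ds i with lookup ds i
... | (e , k , _) = link k ((e ↑ˡ length ds) ∷ []) ((n ↑ʳ i) ∷ [])

doorLab : ∀ {n} (ds : List (Door n)) → Fin (length ds) → Fm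
doorLab ds i with lookup ds i
... | (_ , _ , L) = L

boxNet : (π : PS) → List (Door (nE π)) → PS
boxNet π ds = ps (n +ℕ m)
  (λ e → [ lab π , doorLab ds ]′ (splitAt n e))
  (map (mapLink (_↑ˡ m)) (links π) ++ map (doorLink ds) (allFin m))
  (map (mapBox (_↑ˡ m)) (boxes π)
     ++ (box (map (n ↑ʳ_) (allFin m)) (map (_↑ˡ m) (allFin n)) ∷ []))
  (map (n ↑ʳ_) (allFin m))
  where
    n = nE π
    m = length ds

axNet : Fm → PS
axNet A = ps 2 lb (link axL [] (zero ∷ suc zero ∷ []) ∷ []) [] (zero ∷ suc zero ∷ [])
  where
    lb : Fin 2 → Fm
    lb zero = A
    lb (suc _) = A ⊥

IsWhyNot : Fm → Set
IsWhyNot A = ∃ λ B → A ≡ ?F B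

-- Sequentializable proof nets: the nets of sequent calculus proofs of
-- second-order meLL with paragraph (up to reordering of conclusions).

data ProofNet : PS → Set where
  pn-ax   : ∀ A → Closed A → ProofNet (axNet A)
  pn-exch : ∀ {π} l → ProofNet π → concl π ↭ l →
            ProofNet (ps (nE π) (lab π) (links π) (boxes π) l)
  pn-cut  : ∀ {π π'} Γ a Δ a' → ProofNet π → ProofNet π' →
            concl π ≡ Γ ++ (a ∷ []) → concl π' ≡ Δ ++ (a' ∷ []) →
            lab π' a' ≡ lab π a ⊥ →
            ProofNet (cutNet π π' Γ a Δ a')
  pn-tens : ∀ {π π'} Γ a Δ b → ProofNet π → ProofNet π' →
            concl π ≡ Γ ++ (a ∷ []) → concl π' ≡ Δ ++ (b ∷ []) →
            ProofNet (linkNet (union π π') tensL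
                        (map (_↑ˡ nE π') Γ ++ map (nE π ↑ʳ_) Δ)
                        ((a ↑ˡ nE π') ∷ (nE π ↑ʳ b) ∷ [])
                        (lab π a ⊗ lab π' b))
  pn-par  : ∀ {π} Γ a b → ProofNet π → concl π ≡ Γ ++ (a ∷ b ∷ []) →
            ProofNet (linkNet π parL Γ (a ∷ b ∷ []) (lab π a ⅋ lab π b))
  pn-all  : ∀ {π} Γ a A X → ProofNet π → concl π ≡ Γ ++ (a ∷ []) →
            lab π a ≡ inst 0 (atom X) A →
            occurs X (∀F A) ≡ false →
            All (λ e → occurs X (lab π e) ≡ false) Γ →
            ProofNet (linkNet π allL Γ (a ∷ []) (∀F A))
  pn-ex   : ∀ {π} Γ a A B → ProofNet π → concl π ≡ Γ ++ (a ∷ []) →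
            Closed B → lab π a ≡ inst 0 B A →
            ProofNet (linkNet π exL Γ (a ∷ []) (∃F A))
  pn-flat : ∀ {π} Γ a → ProofNet π → concl π ≡ Γ ++ (a ∷ []) →
            ProofNet (linkNet π flatL Γ (a ∷ []) (?F (lab π a)))
  pn-why  : ∀ {π} Γ qs A → ProofNet π → concl π ≡ Γ ++ qs →
            All (λ e → lab π e ≡ ?F A) qs →
            ProofNet (linkNet π whyL Γ qs (?F A))
  pn-ofc  : ∀ {π} Γ a → ProofNet π → concl π ≡ Γ ++ (a ∷ []) →
            All (λ e → IsWhyNot (lab π e)) Γ →
            ProofNet (boxNet π (map (λ e → (e , paxL , lab π e)) Γ
                                ++ ((a , ofcL , !F (lab π a)) ∷ [])))
  pn-para : ∀ {π} Γ Δ → ProofNet π → concl π ≡ Γ ++ Δ →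
            All (λ e → IsWhyNot (lab π e)) Γ →
            ProofNet (boxNet π (map (λ e → (e , paxL , lab π e)) Γ
                                ++ map (λ e → (e , paraL , §F (lab π e))) Δ))

module _ {n : ℕ} (I : Fin n → ℤ) where

  SameIndex : List (Fin n) → Set
  SameIndex es = Σ ℤ λ k → All (λ e → I e ≡ k) es

  OneMore : List (Fin n) → List (Fin n) → Set
  OneMore qs cs = All (λ p → All (λ c → I p ≡ I c + 1ℤ) cs) qs

  LinkOK : Link n → Set
  LinkOK (link axL qs cs) = SameIndex cs
  LinkOK (link cutL qs cs) = SameIndex qs
  LinkOK (link tensL qs cs) = SameIndex (qs ++ cs)
  LinkOK (link parL qs cs) = SameIndex (qs ++ cs)
  LinkOK (link allL qs cs) = SameIndex (qs ++ cs)
  LinkOK (link exL qs cs) = SameIndex (qs ++ cs)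
  LinkOK (link paxL qs cs) = SameIndex (qs ++ cs)
  LinkOK (link whyL qs cs) = SameIndex (qs ++ cs)
  LinkOK (link ofcL qs cs) = OneMore qs cs
  LinkOK (link paraL qs cs) = OneMore qs cs
  LinkOK (link flatL qs cs) = OneMore qs cs

IsIndexing : (π : PS) → (Fin (nE π) → ℤ) → Set
IsIndexing π I = All (LinkOK I) (links π) × SameIndex I (concl π)

HasIndexing : PS → Set
HasIndexing π = Σ (Fin (nE π) → ℤ) (IsIndexing π)

-- Every constraint of an indexing compares indices of edges attached to
-- one link (or to the conclusions): "equal" or "one more than".  Both kinds
-- of constraint are invariant under translating all indices by a constant,
-- and they only refer to the edges, so they survive renaming the edges.
--
-- For the theorem, let the conclusions of π have index k and those of π'
-- index k'.  On the juxtaposition π'' we use I - k on the edges of π and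
-- I' - k' on the edges of π'.  Then the links coming from π and π' stay
-- correct by the transport lemma, all conclusions get index 0, and the two
-- premises A and A⊥ of the new cut both get index 0, so the cut is correct.
module Submission where

open import Defs
open import Data.Nat using (ℕ) renaming (_+_ to _+ℕ_)
open import Data.Fin using (Fin; _↑ˡ_; _↑ʳ_; splitAt)
open import Data.Fin.Properties using (splitAt-↑ˡ; splitAt-↑ʳ)
open import Data.Sum using ([_,_]′)
open import Data.List using (List; []; _∷_; _++_; map)
open import Data.List.Properties using (map-++)
open import Data.List.Relation.Unary.All as All using (All; []; _∷_)
open import Data.List.Relation.Unary.All.Properties using (map⁺; ++⁺; ++⁻)
open import Data.Integer using (ℤ; _+_; -_; 1ℤ; 0ℤ)
open import Data.Integer.Properties using (+-inverseʳ; +-commutativeSemigroup)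
open import Algebra.Properties.CommutativeSemigroup +-commutativeSemigroup
  using (xy∙z≈xz∙y)
open import Data.Product using (_,_)
open import Relation.Binary.PropositionalEquality
  using (_≡_; trans; cong; subst; module ≡-Reasoning)

module _ {m n : ℕ} (I : Fin m → ℤ) (J : Fin n → ℤ) (g : Fin m → Fin n) (c : ℤ)
         (translates : ∀ e → J (g e) ≡ I e + c) where

  levels-map : ∀ {x es} → All (λ e → I e ≡ x) es → All (λ e → J e ≡ x + c) (map g es)
  levels-map p = map⁺ (All.map (λ {e} q → trans (translates e) (cong (_+ c) q)) p)

  sameIndex-map : ∀ es → SameIndex I es → SameIndex J (map g es)
  sameIndex-map es (x , p) = x + c , levels-map p

  -- the form in which premises and conclusions of a link are listed together
  sameIndex-map-++ : ∀ qs cs → SameIndex I (qs ++ cs) → SameIndex J (map g qs ++ map g cs)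
  sameIndex-map-++ qs cs s = subst (SameIndex J) (map-++ g qs cs) (sameIndex-map (qs ++ cs) s)

  oneMore-map : ∀ qs cs → OneMore I qs cs → OneMore J (map g qs) (map g cs)
  oneMore-map qs cs p = map⁺ (All.map (λ {q} r → map⁺ (All.map (λ {d} → shift q d) r)) p)
    where
      open ≡-Reasoning
      shift : ∀ q d → I q ≡ I d + 1ℤ → J (g q) ≡ J (g d) + 1ℤ
      shift q d s = begin
        J (g q)          ≡⟨ translates q ⟩
        I q + c          ≡⟨ cong (_+ c) s ⟩
        (I d + 1ℤ) + c   ≡⟨ xy∙z≈xz∙y (I d) 1ℤ c ⟩
        (I d + c) + 1ℤ   ≡⟨ cong (_+ 1ℤ) (translates d) ⟨
        J (g d) + 1ℤ     ∎

  linkOK-map : ∀ L → LinkOK I L → LinkOK J (mapLink g L)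
  linkOK-map (link axL qs cs) = sameIndex-map cs
  linkOK-map (link cutL qs cs) = sameIndex-map qs
  linkOK-map (link tensL qs cs) = sameIndex-map-++ qs cs
  linkOK-map (link parL qs cs) = sameIndex-map-++ qs cs
  linkOK-map (link allL qs cs) = sameIndex-map-++ qs cs
  linkOK-map (link exL qs cs) = sameIndex-map-++ qs cs
  linkOK-map (link paxL qs cs) = sameIndex-map-++ qs cs
  linkOK-map (link whyL qs cs) = sameIndex-map-++ qs cs
  linkOK-map (link paraL qs cs) = oneMore-map qs cs
  linkOK-map (link ofcL qs cs) = oneMore-map qs cs
  linkOK-map (link flatL qs cs) = oneMore-map qs cs

  linksOK-map : ∀ Ls → All (LinkOK I) Ls → All (LinkOK J) (map (mapLink g) Ls)
  linksOK-map Ls p = map⁺ (All.map (λ {L} → linkOK-map L) p)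

juxtapose : ∀ {n n'} → (Fin n → ℤ) → (Fin n' → ℤ) → Fin (n +ℕ n') → ℤ
juxtapose {n} I I' e = [ I , I' ]′ (splitAt n e)

juxtapose-↑ˡ : ∀ {n n'} (I : Fin n → ℤ) (I' : Fin n' → ℤ) e →
               juxtapose I I' (e ↑ˡ n') ≡ I e
juxtapose-↑ˡ {n} {n'} I I' e = cong [ I , I' ]′ (splitAt-↑ˡ n e n')

juxtapose-↑ʳ : ∀ {n n'} (I : Fin n → ℤ) (I' : Fin n' → ℤ) e →
               juxtapose I I' (n ↑ʳ e) ≡ I' e
juxtapose-↑ʳ {n} {n'} I I' e = cong [ I , I' ]′ (splitAt-↑ʳ n n' e)

level-cancel : ∀ {n} {K : Fin n → ℤ} {es} k → All (λ e → K e ≡ k + - k) es →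
               All (λ e → K e ≡ 0ℤ) es
level-cancel k = All.map (λ p → trans p (+-inverseʳ k))

mainTheorem6 : (π π' : PS) (Γ : List (Fin (nE π))) (a : Fin (nE π))
    (Δ : List (Fin (nE π'))) (a' : Fin (nE π')) →
    ProofNet π → ProofNet π' →
    concl π ≡ Γ ++ (a ∷ []) → concl π' ≡ Δ ++ (a' ∷ []) →
    lab π' a' ≡ lab π a ⊥ →
    HasIndexing π → HasIndexing π' →
    HasIndexing (cutNet π π' Γ a Δ a')
mainTheorem6 π π' Γ a Δ a' _ _ eq eq' _ (I , linksI , k , conclI) (I' , linksI' , k' , conclI')
  with ++⁻ Γ (subst (All (λ e → I e ≡ k)) eq conclI)
     | ++⁻ Δ (subst (All (λ e → I' e ≡ k')) eq' conclI')
... | Γ-at-k , a-at-k | Δ-at-k' , a'-at-k' =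
  J , ++⁺ (linksOK-map I J l (- k) left (links π) linksI)
          (++⁺ (linksOK-map I' J r (- k') right (links π') linksI') (cut-at-0 ∷ []))
    , 0ℤ , ++⁺ (left-at-0 Γ-at-k) (right-at-0 Δ-at-k')
  where
    n = nE π
    n' = nE π'
    l : Fin n → Fin (n +ℕ n')
    l e = e ↑ˡ n'
    r : Fin n' → Fin (n +ℕ n')
    r e = n ↑ʳ e
    -- lower both indexings so that their conclusions sit at index 0
    J : Fin (n +ℕ n') → ℤ
    J = juxtapose (λ e → I e + - k) (λ e → I' e + - k')
    left : ∀ e → J (l e) ≡ I e + - k
    left = juxtapose-↑ˡ (λ e → I e + - k) (λ e → I' e + - k')
    right : ∀ e → J (r e) ≡ I' e + - k'
    right = juxtapose-↑ʳ (λ e → I e + - k) (λ e → I' e + - k')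
    left-at-0 : ∀ {es} → All (λ e → I e ≡ k) es → All (λ e → J e ≡ 0ℤ) (map l es)
    left-at-0 p = level-cancel k (levels-map I J l (- k) left p)
    right-at-0 : ∀ {es} → All (λ e → I' e ≡ k') es → All (λ e → J e ≡ 0ℤ) (map r es)
    right-at-0 p = level-cancel k' (levels-map I' J r (- k') right p)
    cut-at-0 : LinkOK J (link cutL (l a ∷ r a' ∷ []) [])
    cut-at-0 = 0ℤ , ++⁺ (left-at-0 a-at-k) (right-at-0 a'-at-k')
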